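{- If $\mathcal{C}$ is a suitable model category, then for every object $A$ the slice category $\mathcal{C}/A$, with its induced model structure, is also suitable.
   Context: A model category $\mathcal{C}$ is suitable if (i) it is right proper (weak equivalences are stable under pullback along fibrations); (ii) its cofibrations are exactly its monomorphisms; (iii) $[f,g]:A+B\to C$ is a fibration whenever $f:A\to C$ and $g:B\to C$ are, and the unique morphism $0\to A$ is always a fibration; (iv) as a category, $\mathcal{C}$ is locally cartesian closed (has a terminal object and every slice is cartesian closed). The induced model structure on $\mathcal{C}/A$ has as weak equivalences, fibrations and cofibrations those morphisms whose underlying morphisms in $\mathcal{C}$ are such. -}

module Defs where

open import Level using (Level; _⊔_) renaming (suc to lsuc)
open import Data.Product using (Σ; _×_; _,_; proj₁; proj₂)
open import Relation.Binary.Structures using (IsEquivalence)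

record Category (o ℓ e : Level) : Set (lsuc (o ⊔ ℓ ⊔ e)) where
  infixr 9 _∘_
  infix 4 _≈_ _⇒_
  field
    Obj : Set o
    _⇒_ : Obj → Obj → Set ℓ
    _≈_ : ∀ {A B} → A ⇒ B → A ⇒ B → Set e
    id : ∀ {A} → A ⇒ A
    _∘_ : ∀ {A B C} → B ⇒ C → A ⇒ B → A ⇒ C
    equiv : ∀ {A B} → IsEquivalence (_≈_ {A} {B})
    ∘-resp-≈ : ∀ {A B C} {f h : B ⇒ C} {g i : A ⇒ B} →
               f ≈ h → g ≈ i → f ∘ g ≈ h ∘ i
    identityˡ : ∀ {A B} {f : A ⇒ B} → id ∘ f ≈ f
    identityʳ : ∀ {A B} {f : A ⇒ B} → f ∘ id ≈ f
    assoc : ∀ {A B C D} {f : A ⇒ B} {g : B ⇒ C} {h : C ⇒ D} →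
            (h ∘ g) ∘ f ≈ h ∘ (g ∘ f)

Slice : ∀ {o ℓ e} (C : Category o ℓ e) → Category.Obj C → Category (o ⊔ ℓ) (ℓ ⊔ e) e
Slice {o} {ℓ} {e} C A = record
  { Obj = Σ Obj (λ X → X ⇒ A)
  ; _⇒_ = λ X Y → Σ (proj₁ X ⇒ proj₁ Y) (λ h → proj₂ Y ∘ h ≈ proj₂ X)
  ; _≈_ = λ h k → proj₁ h ≈ proj₁ k
  ; id = id , identityʳ
  ; _∘_ = λ h k → (proj₁ h ∘ proj₁ k) ,
            E.trans (E.sym assoc) (E.trans (∘-resp-≈ (proj₂ h) E.refl) (proj₂ k))
  ; equiv = record { refl = E.refl ; sym = E.sym ; trans = E.trans }
  ; ∘-resp-≈ = ∘-resp-≈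
  ; identityˡ = identityˡ
  ; identityʳ = identityʳ
  ; assoc = assoc
  }
  where
  open Category C
  module E {X Y} = IsEquivalence (equiv {X} {Y})

module _ {o ℓ e : Level} (C : Category o ℓ e) where
  open Category C

  record IsTerminal (T : Obj) : Set (o ⊔ ℓ ⊔ e) where
    field
      ! : ∀ {X} → X ⇒ T
      !-unique : ∀ {X} (f : X ⇒ T) → f ≈ !

  record Terminal : Set (o ⊔ ℓ ⊔ e) where
    field
      ⊤ : Obj
      isTerminal : IsTerminal ⊤

  record IsInitial (I : Obj) : Set (o ⊔ ℓ ⊔ e) where
    field
      ¡ : ∀ {X} → I ⇒ X
      ¡-unique : ∀ {X} (f : I ⇒ X) → ¡ ≈ f

  record Initial : Set (o ⊔ ℓ ⊔ e) where
    field
      ⊥ : Obj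
      isInitial : IsInitial ⊥

  record IsProduct {A B P : Obj} (π₁ : P ⇒ A) (π₂ : P ⇒ B) : Set (o ⊔ ℓ ⊔ e) where
    field
      ⟨_,_⟩ : ∀ {X} → X ⇒ A → X ⇒ B → X ⇒ P
      project₁ : ∀ {X} {f : X ⇒ A} {g : X ⇒ B} → π₁ ∘ ⟨ f , g ⟩ ≈ f
      project₂ : ∀ {X} {f : X ⇒ A} {g : X ⇒ B} → π₂ ∘ ⟨ f , g ⟩ ≈ g
      unique : ∀ {X} {f : X ⇒ A} {g : X ⇒ B} {h : X ⇒ P} →
               π₁ ∘ h ≈ f → π₂ ∘ h ≈ g → h ≈ ⟨ f , g ⟩

  record Product (A B : Obj) : Set (o ⊔ ℓ ⊔ e) where
    field
      A×B : Obj
      π₁ : A×B ⇒ A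
      π₂ : A×B ⇒ B
      isProduct : IsProduct π₁ π₂

  record IsCoproduct {A B S : Obj} (i₁ : A ⇒ S) (i₂ : B ⇒ S) : Set (o ⊔ ℓ ⊔ e) where
    field
      [_,_] : ∀ {X} → A ⇒ X → B ⇒ X → S ⇒ X
      inject₁ : ∀ {X} {f : A ⇒ X} {g : B ⇒ X} → [ f , g ] ∘ i₁ ≈ f
      inject₂ : ∀ {X} {f : A ⇒ X} {g : B ⇒ X} → [ f , g ] ∘ i₂ ≈ g
      unique : ∀ {X} {f : A ⇒ X} {g : B ⇒ X} {h : S ⇒ X} →
               h ∘ i₁ ≈ f → h ∘ i₂ ≈ g → h ≈ [ f , g ]

  record IsPullback {X Y Z P : Obj} (f : X ⇒ Z) (g : Y ⇒ Z)
                    (p₁ : P ⇒ X) (p₂ : P ⇒ Y) : Set (o ⊔ ℓ ⊔ e) where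
    field
      commute : f ∘ p₁ ≈ g ∘ p₂
      universal : ∀ {Q} (q₁ : Q ⇒ X) (q₂ : Q ⇒ Y) → f ∘ q₁ ≈ g ∘ q₂ → Q ⇒ P
      p₁∘universal : ∀ {Q} {q₁ : Q ⇒ X} {q₂ : Q ⇒ Y} {eq : f ∘ q₁ ≈ g ∘ q₂} →
                     p₁ ∘ universal q₁ q₂ eq ≈ q₁
      p₂∘universal : ∀ {Q} {q₁ : Q ⇒ X} {q₂ : Q ⇒ Y} {eq : f ∘ q₁ ≈ g ∘ q₂} →
                     p₂ ∘ universal q₁ q₂ eq ≈ q₂
      unique : ∀ {Q} {q₁ : Q ⇒ X} {q₂ : Q ⇒ Y} {eq : f ∘ q₁ ≈ g ∘ q₂} {h : Q ⇒ P} →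
               p₁ ∘ h ≈ q₁ → p₂ ∘ h ≈ q₂ → h ≈ universal q₁ q₂ eq

  record Pullback {X Y Z : Obj} (f : X ⇒ Z) (g : Y ⇒ Z) : Set (o ⊔ ℓ ⊔ e) where
    field
      P : Obj
      p₁ : P ⇒ X
      p₂ : P ⇒ Y
      isPullback : IsPullback f g p₁ p₂

  record IsPushout {X Y Z Q : Obj} (f : Z ⇒ X) (g : Z ⇒ Y)
                   (i₁ : X ⇒ Q) (i₂ : Y ⇒ Q) : Set (o ⊔ ℓ ⊔ e) where
    field
      commute : i₁ ∘ f ≈ i₂ ∘ g
      universal : ∀ {R} (r₁ : X ⇒ R) (r₂ : Y ⇒ R) → r₁ ∘ f ≈ r₂ ∘ g → Q ⇒ R
      universal∘i₁ : ∀ {R} {r₁ : X ⇒ R} {r₂ : Y ⇒ R} {eq : r₁ ∘ f ≈ r₂ ∘ g} →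
                     universal r₁ r₂ eq ∘ i₁ ≈ r₁
      universal∘i₂ : ∀ {R} {r₁ : X ⇒ R} {r₂ : Y ⇒ R} {eq : r₁ ∘ f ≈ r₂ ∘ g} →
                     universal r₁ r₂ eq ∘ i₂ ≈ r₂
      unique : ∀ {R} {r₁ : X ⇒ R} {r₂ : Y ⇒ R} {eq : r₁ ∘ f ≈ r₂ ∘ g} {h : Q ⇒ R} →
               h ∘ i₁ ≈ r₁ → h ∘ i₂ ≈ r₂ → h ≈ universal r₁ r₂ eq

  record Pushout {X Y Z : Obj} (f : Z ⇒ X) (g : Z ⇒ Y) : Set (o ⊔ ℓ ⊔ e) where
    field
      Q : Obj
      i₁ : X ⇒ Q
      i₂ : Y ⇒ Q
      isPushout : IsPushout f g i₁ i₂

  record FinitelyComplete : Set (o ⊔ ℓ ⊔ e) where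
    field
      terminal : Terminal
      pullback : ∀ {X Y Z} (f : X ⇒ Z) (g : Y ⇒ Z) → Pullback f g

  record FinitelyCocomplete : Set (o ⊔ ℓ ⊔ e) where
    field
      initial : Initial
      pushout : ∀ {X Y Z} (f : Z ⇒ X) (g : Z ⇒ Y) → Pushout f g

  module _ (product : ∀ A B → Product A B) where
    ×id : ∀ {X E B} → X ⇒ E → Product.A×B (product X B) ⇒ Product.A×B (product E B)
    ×id {X} {E} {B} h =
      IsProduct.⟨_,_⟩ (Product.isProduct (product E B))
        (h ∘ Product.π₁ (product X B)) (Product.π₂ (product X B))

    record Exponential (B D : Obj) : Set (o ⊔ ℓ ⊔ e) where
      field
        D^B : Obj
        eval : Product.A×B (product D^B B) ⇒ D
        curry : ∀ {X} → Product.A×B (product X B) ⇒ D → X ⇒ D^B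
        β : ∀ {X} {f : Product.A×B (product X B) ⇒ D} → eval ∘ ×id (curry f) ≈ f
        unique : ∀ {X} {f : Product.A×B (product X B) ⇒ D} {h : X ⇒ D^B} →
                 eval ∘ ×id h ≈ f → h ≈ curry f

  record CartesianClosed : Set (o ⊔ ℓ ⊔ e) where
    field
      terminal : Terminal
      product : ∀ A B → Product A B
      exponential : ∀ B D → Exponential product B D

  record Mono {X Y : Obj} (f : X ⇒ Y) : Set (o ⊔ ℓ ⊔ e) where
    field
      cancel : ∀ {Z} (g h : Z ⇒ X) → f ∘ g ≈ f ∘ h → g ≈ h

  record IsRetractOf {A B X Y : Obj} (f : A ⇒ B) (g : X ⇒ Y) : Set (ℓ ⊔ e) where
    field
      i : A ⇒ X
      r : X ⇒ A
      j : B ⇒ Y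
      s : Y ⇒ B
      r∘i : r ∘ i ≈ id
      s∘j : s ∘ j ≈ id
      sq₁ : g ∘ i ≈ j ∘ f
      sq₂ : f ∘ r ≈ s ∘ g

  HasLift : ∀ {A B X Y : Obj} (i : A ⇒ B) (p : X ⇒ Y) → Set (ℓ ⊔ e)
  HasLift {A} {B} {X} {Y} i p =
    ∀ (u : A ⇒ X) (v : B ⇒ Y) → p ∘ u ≈ v ∘ i →
      Σ (B ⇒ X) λ d → (d ∘ i ≈ u) × (p ∘ d ≈ v)

Class : ∀ {o ℓ e} (C : Category o ℓ e) (p : Level) → Set (o ⊔ ℓ ⊔ lsuc p)
Class C p = ∀ {X Y : Category.Obj C} → Category._⇒_ C X Y → Set p

module _ {o ℓ e p : Level} (C : Category o ℓ e) where
  open Category C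

  record Factorization (L R : Class C p) {X Y : Obj} (f : X ⇒ Y) : Set (o ⊔ ℓ ⊔ e ⊔ p) where
    field
      mid : Obj
      left : X ⇒ mid
      right : mid ⇒ Y
      left∈L : L left
      right∈R : R right
      factors : right ∘ left ≈ f

  record LCCC : Set (lsuc (o ⊔ ℓ ⊔ e)) where
    field
      terminal : Terminal C
      slice-ccc : ∀ A → CartesianClosed (Slice C A)

  record IsModelStructure (W Cof Fib : Class C p) : Set (o ⊔ ℓ ⊔ e ⊔ p) where
    field
      finitelyComplete : FinitelyComplete C
      finitelyCocomplete : FinitelyCocomplete C
      W-resp-≈ : ∀ {X Y} {f g : X ⇒ Y} → f ≈ g → W f → W g
      Cof-resp-≈ : ∀ {X Y} {f g : X ⇒ Y} → f ≈ g → Cof f → Cof g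
      Fib-resp-≈ : ∀ {X Y} {f g : X ⇒ Y} → f ≈ g → Fib f → Fib g
      W-∘ : ∀ {X Y Z} {f : X ⇒ Y} {g : Y ⇒ Z} → W f → W g → W (g ∘ f)
      W-cancelʳ : ∀ {X Y Z} {f : X ⇒ Y} {g : Y ⇒ Z} → W f → W (g ∘ f) → W g
      W-cancelˡ : ∀ {X Y Z} {f : X ⇒ Y} {g : Y ⇒ Z} → W g → W (g ∘ f) → W f
      W-retract : ∀ {A B X Y} {f : A ⇒ B} {g : X ⇒ Y} → IsRetractOf C f g → W g → W f
      Cof-retract : ∀ {A B X Y} {f : A ⇒ B} {g : X ⇒ Y} → IsRetractOf C f g → Cof g → Cof f
      Fib-retract : ∀ {A B X Y} {f : A ⇒ B} {g : X ⇒ Y} → IsRetractOf C f g → Fib g → Fib f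
      lift-trivCof : ∀ {A B X Y} {i : A ⇒ B} {q : X ⇒ Y} →
                     Cof i → W i → Fib q → HasLift C i q
      lift-trivFib : ∀ {A B X Y} {i : A ⇒ B} {q : X ⇒ Y} →
                     Cof i → Fib q → W q → HasLift C i q
      factor-trivCof-Fib : ∀ {X Y} (f : X ⇒ Y) →
                           Factorization (λ i → Cof i × W i) Fib f
      factor-Cof-trivFib : ∀ {X Y} (f : X ⇒ Y) →
                           Factorization Cof (λ q → W q × Fib q) f

  record IsSuitable (W Cof Fib : Class C p) : Set (lsuc (o ⊔ ℓ ⊔ e) ⊔ p) where
    field
      isModelStructure : IsModelStructure W Cof Fib
      right-proper : ∀ {X Y Z P} {w : X ⇒ Z} {q : Y ⇒ Z} {p₁ : P ⇒ X} {p₂ : P ⇒ Y} →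
                     IsPullback C w q p₁ p₂ → Fib q → W w → W p₂
      Cof⇒Mono : ∀ {X Y} {f : X ⇒ Y} → Cof f → Mono C f
      Mono⇒Cof : ∀ {X Y} {f : X ⇒ Y} → Mono C f → Cof f
      copair-Fib : ∀ {A B S D} {i₁ : A ⇒ S} {i₂ : B ⇒ S} (c : IsCoproduct C i₁ i₂)
                     {f : A ⇒ D} {g : B ⇒ D} →
                   Fib f → Fib g → Fib (IsCoproduct.[_,_] c f g)
      initial-Fib : ∀ {I} (init : IsInitial C I) {X} → Fib (IsInitial.¡ init {X})
      lccc : LCCC

Induced : ∀ {o ℓ e p} (C : Category o ℓ e) (A : Category.Obj C) →
          Class C p → Class (Slice C A) p
Induced C A P h = P (proj₁ h)

module Submission where

open import Defs
open import Level using (Level; _⊔_)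
open import Data.Product using (_,_; proj₁; proj₂)
open import Relation.Binary.Structures using (IsEquivalence)

-- Every requirement on C/A is reduced to the same requirement on C: weak
-- equivalences, (co)fibrations, monos and pullbacks in C/A are those of C, and
-- lifts and factorizations in C automatically lie over A.  The two colimit
-- conditions of (iii) concern arbitrary initial objects and coproducts of C/A;
-- these are isomorphic to ones computed in C, so the relevant maps are retracts
-- of fibrations of C.  Finally (C/A)/(X → A) is isomorphic to C/X, which is
-- cartesian closed.

module HomReasoning {o ℓ e : Level} (D : Category o ℓ e) where
  open Category D

  module ≈ {X Y} = IsEquivalence (equiv {X} {Y})

  infixr 4 _○_
  _○_ : ∀ {X Y} {f g h : X ⇒ Y} → f ≈ g → g ≈ h → f ≈ h
  _○_ = ≈.trans

  ⟺ : ∀ {X Y} {f g : X ⇒ Y} → f ≈ g → g ≈ f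
  ⟺ = ≈.sym

  ∘-resp-≈ˡ : ∀ {X Y Z} {f g : Y ⇒ Z} {h : X ⇒ Y} → f ≈ g → f ∘ h ≈ g ∘ h
  ∘-resp-≈ˡ eq = ∘-resp-≈ eq ≈.refl

  ∘-resp-≈ʳ : ∀ {X Y Z} {f g : X ⇒ Y} {h : Y ⇒ Z} → f ≈ g → h ∘ f ≈ h ∘ g
  ∘-resp-≈ʳ eq = ∘-resp-≈ ≈.refl eq

module _ {o ℓ e : Level} (D : Category o ℓ e) where
  open Category D
  open HomReasoning D

  initial-¡-retract : ∀ {I I'} (init : IsInitial D I) (init' : IsInitial D I') {X} →
                      IsRetractOf D (IsInitial.¡ init {X}) (IsInitial.¡ init' {X})
  initial-¡-retract init init' = record
    { i = I.¡ ; r = I'.¡ ; j = id ; s = id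
    ; r∘i = ⟺ (I.¡-unique _) ○ I.¡-unique _
    ; s∘j = identityˡ
    ; sq₁ = ⟺ (I.¡-unique _) ○ I.¡-unique _
    ; sq₂ = ⟺ (I'.¡-unique _) ○ I'.¡-unique _
    }
    where
    module I = IsInitial init
    module I' = IsInitial init'

  module _ {A B S} {i₁ : A ⇒ S} {i₂ : B ⇒ S} (c : IsCoproduct D i₁ i₂) where
    open IsCoproduct c

    ∘-copair-inject₁ : ∀ {X Y} {u : A ⇒ X} {v : B ⇒ X} {h : X ⇒ Y} →
                       (h ∘ [ u , v ]) ∘ i₁ ≈ h ∘ u
    ∘-copair-inject₁ = assoc ○ ∘-resp-≈ʳ inject₁

    ∘-copair-inject₂ : ∀ {X Y} {u : A ⇒ X} {v : B ⇒ X} {h : X ⇒ Y} →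
                       (h ∘ [ u , v ]) ∘ i₂ ≈ h ∘ v
    ∘-copair-inject₂ = assoc ○ ∘-resp-≈ʳ inject₂

  copair-retract : ∀ {A B S S'} {i₁ : A ⇒ S} {i₂ : B ⇒ S} {i₁' : A ⇒ S'} {i₂' : B ⇒ S'}
                   (c : IsCoproduct D i₁ i₂) (c' : IsCoproduct D i₁' i₂')
                   {X} {f : A ⇒ X} {g : B ⇒ X} →
                   IsRetractOf D (IsCoproduct.[_,_] c f g) (IsCoproduct.[_,_] c' f g)
  copair-retract {i₁ = i₁} {i₂} {i₁'} {i₂'} c c' = record
    { i = c.[ i₁' , i₂' ] ; r = c'.[ i₁ , i₂ ] ; j = id ; s = id
    ; r∘i = through-c' ○ ⟺ (c.unique identityˡ identityˡ)
    ; s∘j = identityˡ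
    ; sq₁ = through-c' ○ ⟺ identityˡ
    ; sq₂ = c'.unique (∘-copair-inject₁ c' ○ c.inject₁) (∘-copair-inject₂ c' ○ c.inject₂)
            ○ ⟺ identityˡ
    }
    where
    module c = IsCoproduct c
    module c' = IsCoproduct c'
    through-c' : ∀ {Y} {u : _ ⇒ Y} {v : _ ⇒ Y} → c'.[ u , v ] ∘ c.[ i₁' , i₂' ] ≈ c.[ u , v ]
    through-c' = c.unique (∘-copair-inject₁ c ○ c'.inject₁) (∘-copair-inject₂ c ○ c'.inject₂)

  pushout-of-initial-isCoproduct : ∀ {I X Y Q} (init : IsInitial D I)
                                   {i₁ : X ⇒ Q} {i₂ : Y ⇒ Q} →
                                   IsPushout D (IsInitial.¡ init) (IsInitial.¡ init) i₁ i₂ →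
                                   IsCoproduct D i₁ i₂
  pushout-of-initial-isCoproduct init po = record
    { [_,_] = λ u v → universal u v (⟺ (¡-unique _) ○ ¡-unique _)
    ; inject₁ = universal∘i₁
    ; inject₂ = universal∘i₂
    ; unique = unique
    }
    where
    open IsInitial init
    open IsPushout po

  ⟨⟩-resp-≈ : ∀ {A B P} {π₁ : P ⇒ A} {π₂ : P ⇒ B} (prod : IsProduct D π₁ π₂)
              {X} {f f' : X ⇒ A} {g g' : X ⇒ B} →
              f ≈ f' → g ≈ g' → IsProduct.⟨_,_⟩ prod f g ≈ IsProduct.⟨_,_⟩ prod f' g'
  ⟨⟩-resp-≈ prod eq₁ eq₂ = unique (project₁ ○ eq₁) (project₂ ○ eq₂)
    where open IsProduct prod

module SliceProperties {o ℓ e : Level} (C : Category o ℓ e) (A : Category.Obj C) where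
  open Category C
  open HomReasoning C

  C/A : Category (o ⊔ ℓ) (ℓ ⊔ e) e
  C/A = Slice C A

  module C/A = Category C/A

  factor-over : ∀ {B X Y : C/A.Obj} {q : X C/A.⇒ Y} {v : B C/A.⇒ Y} {d : proj₁ B ⇒ proj₁ X} →
                proj₁ q ∘ d ≈ proj₁ v → proj₂ X ∘ d ≈ proj₂ B
  factor-over {q = q} {v} eq = ∘-resp-≈ˡ (⟺ (proj₂ q)) ○ assoc ○ ∘-resp-≈ʳ eq ○ proj₂ v

  square-over : ∀ {Q} {X Y Z : C/A.Obj} {f : X C/A.⇒ Z} {g : Y C/A.⇒ Z}
                {q₁ : Q ⇒ proj₁ X} {q₂ : Q ⇒ proj₁ Y} →
                proj₁ f ∘ q₁ ≈ proj₁ g ∘ q₂ → proj₂ Y ∘ q₂ ≈ proj₂ X ∘ q₁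
  square-over {X = X} {f = f} {g} {q₁} eq =
    factor-over {B = _ , proj₂ X ∘ q₁} {q = g} {v = f C/A.∘ (q₁ , ≈.refl)} (⟺ eq)

  retract-underlying : ∀ {a b x y : C/A.Obj} {f : a C/A.⇒ b} {g : x C/A.⇒ y} →
                       IsRetractOf C/A f g → IsRetractOf C (proj₁ f) (proj₁ g)
  retract-underlying ret = record
    { i = proj₁ i ; r = proj₁ r ; j = proj₁ j ; s = proj₁ s
    ; r∘i = r∘i ; s∘j = s∘j ; sq₁ = sq₁ ; sq₂ = sq₂ }
    where open IsRetractOf ret

  lift-slice : ∀ {a b x y : C/A.Obj} {i : a C/A.⇒ b} {q : x C/A.⇒ y} →
               HasLift C (proj₁ i) (proj₁ q) → HasLift C/A i q
  lift-slice {q = q} lift u v comm with lift (proj₁ u) (proj₁ v) comm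
  ... | d , d∘i≈u , q∘d≈v = (d , factor-over {q = q} {v = v} q∘d≈v) , d∘i≈u , q∘d≈v

  factorization-slice : ∀ {p} {L R : Class C p} {X Y : C/A.Obj} {f : X C/A.⇒ Y} →
                        Factorization C L R (proj₁ f) →
                        Factorization C/A (Induced C A L) (Induced C A R) f
  factorization-slice {Y = Y} {f} F = record
    { mid = mid , proj₂ Y ∘ right
    ; left = left , factor-over {q = right , ≈.refl} {v = f} factors
    ; right = right , ≈.refl
    ; left∈L = left∈L
    ; right∈R = right∈R
    ; factors = factors
    }
    where open Factorization F

  slice-mono⇒mono : ∀ {X Y : C/A.Obj} {f : X C/A.⇒ Y} → Mono C/A f → Mono C (proj₁ f)
  slice-mono⇒mono {f = f} m = record
    { cancel = λ g h eq → Mono.cancel m (g , ≈.refl) (h , square-over {f = f} {g = f} eq) eq }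

  mono⇒slice-mono : ∀ {X Y : C/A.Obj} {f : X C/A.⇒ Y} → Mono C (proj₁ f) → Mono C/A f
  mono⇒slice-mono m = record { cancel = λ g h → Mono.cancel m (proj₁ g) (proj₁ h) }

  pullback-underlying : ∀ {X Y Z P : C/A.Obj} {f : X C/A.⇒ Z} {g : Y C/A.⇒ Z}
                        {p₁ : P C/A.⇒ X} {p₂ : P C/A.⇒ Y} →
                        IsPullback C/A f g p₁ p₂ →
                        IsPullback C (proj₁ f) (proj₁ g) (proj₁ p₁) (proj₁ p₂)
  pullback-underlying {X} {f = f} {g} {p₁} pb = record
    { commute = commute
    ; universal = λ q₁ q₂ eq → proj₁ (over q₁ q₂ eq)
    ; p₁∘universal = p₁∘universal
    ; p₂∘universal = p₂∘universal
    ; unique = λ {_} {q₁} {q₂} {eq} {h} e₁ e₂ →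
        unique {eq = eq} {h = h , factor-over {q = p₁} {v = q₁ , ≈.refl} e₁} e₁ e₂
    }
    where
    open IsPullback pb
    over : ∀ {Q} (q₁ : Q ⇒ proj₁ X) q₂ (eq : proj₁ f ∘ q₁ ≈ proj₁ g ∘ q₂) →
           (Q , proj₂ X ∘ q₁) C/A.⇒ _
    over q₁ q₂ eq = universal (q₁ , ≈.refl) (q₂ , square-over {f = f} {g} eq) eq

  slice-pullback : ∀ {X Y Z : C/A.Obj} {f : X C/A.⇒ Z} {g : Y C/A.⇒ Z} →
                   Pullback C (proj₁ f) (proj₁ g) → Pullback C/A f g
  slice-pullback {X} {f = f} {g} pb = record
    { P = P , proj₂ X ∘ p₁
    ; p₁ = p₁ , ≈.refl
    ; p₂ = p₂ , square-over {f = f} {g} commute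
    ; isPullback = record
      { commute = commute
      ; universal = λ q₁ q₂ eq → universal (proj₁ q₁) (proj₁ q₂) eq ,
                                 factor-over {q = p₁ , ≈.refl} {v = q₁} p₁∘universal
      ; p₁∘universal = p₁∘universal
      ; p₂∘universal = p₂∘universal
      ; unique = unique
      }
    }
    where
    open Pullback pb
    open IsPullback isPullback

  slice-terminal : Terminal C/A
  slice-terminal = record
    { ⊤ = A , id
    ; isTerminal = record
      { ! = λ {X} → proj₂ X , identityˡ
      ; !-unique = λ f → ⟺ identityˡ ○ proj₂ f
      }
    }

  slice-finitelyComplete : FinitelyComplete C → FinitelyComplete C/A
  slice-finitelyComplete fc = record
    { terminal = slice-terminal
    ; pullback = λ f g → slice-pullback (FinitelyComplete.pullback fc (proj₁ f) (proj₁ g))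
    }

  slice-initial : Initial C → Initial C/A
  slice-initial init = record
    { ⊥ = ⊥ , ¡
    ; isInitial = record
      { ¡ = ¡ , ⟺ (¡-unique _)
      ; ¡-unique = λ f → ¡-unique (proj₁ f)
      }
    }
    where
    open Initial init
    open IsInitial isInitial

  slice-pushout : ∀ {X Y Z : C/A.Obj} {f : Z C/A.⇒ X} {g : Z C/A.⇒ Y} →
                  Pushout C (proj₁ f) (proj₁ g) → Pushout C/A f g
  slice-pushout {X} {Y} {f = f} {g} po = record
    { Q = Q , universal (proj₂ X) (proj₂ Y) (proj₂ f ○ ⟺ (proj₂ g))
    ; i₁ = i₁ , universal∘i₁
    ; i₂ = i₂ , universal∘i₂
    ; isPushout = record
      { commute = commute
      ; universal = λ r₁ r₂ eq → universal (proj₁ r₁) (proj₁ r₂) eq ,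
          unique (assoc ○ ∘-resp-≈ʳ universal∘i₁ ○ proj₂ r₁)
                 (assoc ○ ∘-resp-≈ʳ universal∘i₂ ○ proj₂ r₂)
      ; universal∘i₁ = universal∘i₁
      ; universal∘i₂ = universal∘i₂
      ; unique = unique
      }
    }
    where
    open Pushout po
    open IsPushout isPushout

  slice-finitelyCocomplete : FinitelyCocomplete C → FinitelyCocomplete C/A
  slice-finitelyCocomplete fcc = record
    { initial = slice-initial (FinitelyCocomplete.initial fcc)
    ; pushout = λ f g → slice-pushout (FinitelyCocomplete.pushout fcc (proj₁ f) (proj₁ g))
    }

  slice-coproduct : ∀ {a b : C/A.Obj} {S} {i₁ : proj₁ a ⇒ S} {i₂ : proj₁ b ⇒ S}
                    (c : IsCoproduct C i₁ i₂) →
                    IsCoproduct C/A {a} {b} {S , IsCoproduct.[_,_] c (proj₂ a) (proj₂ b)}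
                      (i₁ , IsCoproduct.inject₁ c) (i₂ , IsCoproduct.inject₂ c)
  slice-coproduct c = record
    { [_,_] = λ f g → [ proj₁ f , proj₁ g ] ,
                      unique (∘-copair-inject₁ C c ○ proj₂ f) (∘-copair-inject₂ C c ○ proj₂ g)
    ; inject₁ = inject₁
    ; inject₂ = inject₂
    ; unique = unique
    }
    where open IsCoproduct c

  module IteratedSlice {X : Obj} (x : X ⇒ A) where
    C/A/X : Category (o ⊔ ℓ ⊔ e) (ℓ ⊔ e) e
    C/A/X = Slice C/A (X , x)

    module C/A/X = Category C/A/X

    C/X : Category (o ⊔ ℓ) (ℓ ⊔ e) e
    C/X = Slice C X

    module C/X = Category C/X

    forget : C/A/X.Obj → C/X.Obj
    forget V = proj₁ (proj₁ V) , proj₁ (proj₂ V)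

    over-A : C/X.Obj → C/A/X.Obj
    over-A Y = (proj₁ Y , x ∘ proj₂ Y) , (proj₂ Y , ≈.refl)

    forget₁ : ∀ V V' → V C/A/X.⇒ V' → forget V C/X.⇒ forget V'
    forget₁ _ _ f = proj₁ (proj₁ f) , proj₂ f

    unforget₁ : ∀ V V' → forget V C/X.⇒ forget V' → V C/A/X.⇒ V'
    unforget₁ V V' f = (proj₁ f , factor-over {q = proj₂ V'} {v = proj₂ V} (proj₂ f)) , proj₂ f

    slice-ccc : CartesianClosed C/X → CartesianClosed C/A/X
    slice-ccc ccc = record
      { terminal = record
        { ⊤ = over-A T.⊤
        ; isTerminal = record
          { ! = λ {V} → unforget₁ V (over-A T.⊤) T.!
          ; !-unique = λ {V} f → T.!-unique (forget₁ V (over-A T.⊤) f)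
          }
        }
      ; product = product
      ; exponential = exponential
      }
      where
      open CartesianClosed ccc using () renaming (product to productˣ; exponential to exponentialˣ)
      module T where
        open Terminal (CartesianClosed.terminal ccc) public
        open IsTerminal isTerminal public

      product : ∀ V V' → Product C/A/X V V'
      product V V' = record
        { A×B = over-A A×B
        ; π₁ = unforget₁ (over-A A×B) V π₁
        ; π₂ = unforget₁ (over-A A×B) V' π₂
        ; isProduct = record
          { ⟨_,_⟩ = λ {Z} f g → unforget₁ Z (over-A A×B) ⟨ forget₁ Z V f , forget₁ Z V' g ⟩
          ; project₁ = project₁
          ; project₂ = project₂
          ; unique = λ {Z} {_} {_} {h} → unique {h = forget₁ Z (over-A A×B) h}
          }
        }
        where
        open Product (productˣ (forget V) (forget V'))
        open IsProduct isProduct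

      exponential : ∀ B D → Exponential C/A/X product B D
      exponential B D = record
        { D^B = over-A D^B
        ; eval = unforget₁ (over-A P.A×B) D eval
        ; curry = λ {Z} → curry/A Z
        -- The ×id of C/A/X and of C/X pair the same maps, with different proofs that they lie over X.
        ; β = ∘-resp-≈ʳ (⟨⟩-resp-≈ C/X P.isProduct ≈.refl ≈.refl) ○ β
        ; unique = λ {Z} {_} {h} eq →
            unique {h = forget₁ Z (over-A D^B) h} (∘-resp-≈ʳ (⟨⟩-resp-≈ C/X P.isProduct ≈.refl ≈.refl) ○ eq)
        }
        where
        open Exponential (exponentialˣ (forget B) (forget D))
        module P = Product (productˣ D^B (forget B))
        curry/A : ∀ Z → Product.A×B (product Z B) C/A/X.⇒ D → Z C/A/X.⇒ over-A D^B
        curry/A Z f = unforget₁ Z (over-A D^B) (curry (forget₁ (Product.A×B (product Z B)) D f))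

  slice-lccc : ∀ {p} → LCCC {p = p} C → LCCC {p = p} C/A
  slice-lccc lccc = record
    { terminal = slice-terminal
    ; slice-ccc = λ U → IteratedSlice.slice-ccc (proj₂ U) (LCCC.slice-ccc lccc (proj₁ U))
    }

  module _ {p} {W Cof Fib : Class C p} where
    W/A Cof/A Fib/A : Class C/A p
    W/A = Induced C A W
    Cof/A = Induced C A Cof
    Fib/A = Induced C A Fib

    slice-isModelStructure : IsModelStructure C W Cof Fib → IsModelStructure C/A W/A Cof/A Fib/A
    slice-isModelStructure M = record
      { finitelyComplete = slice-finitelyComplete finitelyComplete
      ; finitelyCocomplete = slice-finitelyCocomplete finitelyCocomplete
      ; W-resp-≈ = W-resp-≈
      ; Cof-resp-≈ = Cof-resp-≈
      ; Fib-resp-≈ = Fib-resp-≈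
      ; W-∘ = W-∘
      ; W-cancelʳ = W-cancelʳ
      ; W-cancelˡ = W-cancelˡ
      ; W-retract = λ r → W-retract (retract-underlying r)
      ; Cof-retract = λ r → Cof-retract (retract-underlying r)
      ; Fib-retract = λ r → Fib-retract (retract-underlying r)
      ; lift-trivCof = λ {_} {_} {_} {_} {i} {q} cof w fib →
          lift-slice {i = i} {q = q} (lift-trivCof cof w fib)
      ; lift-trivFib = λ {_} {_} {_} {_} {i} {q} cof fib w →
          lift-slice {i = i} {q = q} (lift-trivFib cof fib w)
      ; factor-trivCof-Fib = λ f → factorization-slice {f = f} (factor-trivCof-Fib (proj₁ f))
      ; factor-Cof-trivFib = λ f → factorization-slice {f = f} (factor-Cof-trivFib (proj₁ f))
      }
      where open IsModelStructure M

    module _ (S : IsSuitable C W Cof Fib) where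
      open IsSuitable S
      open IsModelStructure isModelStructure using (Fib-retract; finitelyCocomplete)
      open Initial (FinitelyCocomplete.initial finitelyCocomplete)
        renaming (isInitial to 0-initial)

      slice-initial-Fib : ∀ {I : C/A.Obj} (init : IsInitial C/A I) {X : C/A.Obj} →
                          Fib/A (IsInitial.¡ init {X})
      slice-initial-Fib init =
        Fib-retract (retract-underlying (initial-¡-retract C/A init 0/A-initial)) (initial-Fib 0-initial)
        where
        0/A-initial : IsInitial C/A (⊥ , IsInitial.¡ 0-initial)
        0/A-initial = Initial.isInitial (slice-initial (FinitelyCocomplete.initial finitelyCocomplete))

      slice-copair-Fib : ∀ {a b s d : C/A.Obj} {i₁ : a C/A.⇒ s} {i₂ : b C/A.⇒ s}
                         (c : IsCoproduct C/A i₁ i₂) {f : a C/A.⇒ d} {g : b C/A.⇒ d} →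
                         Fib/A f → Fib/A g → Fib/A (IsCoproduct.[_,_] c f g)
      slice-copair-Fib {a} {b} c fib-f fib-g =
        Fib-retract (retract-underlying (copair-retract C/A c (slice-coproduct a+b)))
                    (copair-Fib a+b fib-f fib-g)
        where
        open Pushout (FinitelyCocomplete.pushout finitelyCocomplete
                        (IsInitial.¡ 0-initial {proj₁ a}) (IsInitial.¡ 0-initial {proj₁ b}))
        a+b : IsCoproduct C i₁ i₂
        a+b = pushout-of-initial-isCoproduct C 0-initial isPushout

      slice-isSuitable : IsSuitable C/A W/A Cof/A Fib/A
      slice-isSuitable = record
        { isModelStructure = slice-isModelStructure isModelStructure
        ; right-proper = λ pb → right-proper (pullback-underlying pb)
        ; Cof⇒Mono = λ cof → mono⇒slice-mono (Cof⇒Mono cof)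
        ; Mono⇒Cof = λ mono → Mono⇒Cof (slice-mono⇒mono mono)
        ; copair-Fib = slice-copair-Fib
        ; initial-Fib = slice-initial-Fib
        ; lccc = slice-lccc lccc
        }

proposition3p2p2 : ∀ {o ℓ e p : Level} (C : Category o ℓ e) (W Cof Fib : Class C p) →
                     IsSuitable C W Cof Fib →
                     (A : Category.Obj C) →
                     IsSuitable (Slice C A) (Induced C A W) (Induced C A Cof) (Induced C A Fib)
proposition3p2p2 C W Cof Fib S A = SliceProperties.slice-isSuitable C A S
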